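{- For integers $n\ge1$ and $d\ge0$, let $A(n,d)$ denote the set of permutations in $S_n$ with exactly $d$ descents which begin with an ascent, and let $a(n,d)=|A(n,d)|$. Then \[ a(n,d)=(d+1)E(n-1,d). \]
   Context: For a permutation $\pi=\pi_1\cdots\pi_n\in S_n$, a position $i\in\{1,\dots,n-1\}$ is an ascent if $\pi_i<\pi_{i+1}$ and a descent if $\pi_i>\pi_{i+1}$; $\pi$ begins with an ascent if position 1 is not a descent. $E(n,d)$ denotes the Eulerian number: the number of permutations of $[n]$ with exactly $d$ descents, with $E(0,0)=1$ and $E(0,d)=0$ for $d\ge1$. -}

module Defs where

open import Data.Nat using (ℕ; zero; suc; _+_; _<ᵇ_)
open import Data.Bool using (Bool; true; false; not; _∧_; if_then_else_)
open import Data.Fin using (Fin; toℕ)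
open import Data.Fin.Properties using (_≟_)
open import Data.Vec using (Vec; []; _∷_; toList)
open import Data.List using (List; []; _∷_; map; concatMap; length; filterᵇ)
open import Relation.Nullary.Decidable using (does)

allFin : (n : ℕ) → List (Fin n)
allFin n = Data.List.allFin n

words : (k n : ℕ) → List (Vec (Fin n) k)
words zero    n = [] ∷ []
words (suc k) n = concatMap (λ i → map (i ∷_) (words k n)) (allFin n)

distinctᵇ : {n : ℕ} → List (Fin n) → Bool
distinctᵇ []       = true
distinctᵇ (x ∷ xs) = not (elemᵇ x xs) ∧ distinctᵇ xs
  where
  elemᵇ : _ → List _ → Bool
  elemᵇ y []       = false
  elemᵇ y (z ∷ zs) = does (y ≟ z) Data.Bool.∨ elemᵇ y zs

-- The permutations of [n] = {0,…,n-1} in one-line notation π₁⋯πₙ: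
-- words of length n over [n] with pairwise distinct entries.
Perms : (n : ℕ) → List (Vec (Fin n) n)
Perms n = filterᵇ (λ v → distinctᵇ (toList v)) (words n n)

desList : {n : ℕ} → List (Fin n) → ℕ
desList []             = 0
desList (x ∷ [])       = 0
desList (x ∷ y ∷ rest) = (if toℕ y <ᵇ toℕ x then 1 else 0) + desList (y ∷ rest)

des : {n k : ℕ} → Vec (Fin n) k → ℕ
des v = desList (toList v)

beginsWithAscentList : {n : ℕ} → List (Fin n) → Bool
beginsWithAscentList (x ∷ y ∷ _) = not (toℕ y <ᵇ toℕ x)
beginsWithAscentList _           = true

beginsWithAscent : {n k : ℕ} → Vec (Fin n) k → Bool
beginsWithAscent v = beginsWithAscentList (toList v)

_==_ : ℕ → ℕ → Bool
m == n = Data.Nat._≡ᵇ_ m n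

E : ℕ → ℕ → ℕ
E n d = length (filterᵇ (λ π → des π == d) (Perms n))

a : ℕ → ℕ → ℕ
a n d = length (filterᵇ (λ π → beginsWithAscent π ∧ (des π == d)) (Perms n))

-- Write a permutation π of [n+1] as j ∷ punchIn j τ with τ a permutation of [n]. Then π has
-- one more descent than τ if τ starts below j and as many otherwise, and π begins with an
-- ascent exactly in the second case. Summing over j gives a(n+1,d) + b(n+1,d+1) = (n+1)E(n,d),
-- where b counts permutations beginning with a descent, and a + b = E always. Together with
-- the Eulerian recurrence E(n+1,d) = (d+1)E(n,d) + (n+1-d)E(n,d-1) this yields
-- a(n+1,d) = (d+1)E(n,d) by induction on d. The recurrence follows by summing its refinement
-- by first entry, which the same decomposition proves by induction on n.

module Submission where

open import Data.Bool using (Bool; true; false; not; _∧_; _∨_; if_then_else_)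
open import Data.Bool.Properties using (∧-assoc; ∧-zeroʳ; if-eta)
open import Data.Fin using (Fin; zero; suc; toℕ; punchIn; inject₁; fromℕ)
open import Data.Fin.Properties using (_≟_; punchIn-injective; punchInᵢ≢i; toℕ-inject₁; toℕ-fromℕ)
open import Data.List using (List; []; _∷_; _++_; map; concatMap; length; filterᵇ; tabulate)
open import Data.Nat using (ℕ; zero; suc; _+_; _*_; _∸_; _≤_; _<ᵇ_)
open import Data.Nat.Properties using (+-*-semiring; +-assoc; +-comm; +-suc; +-identityʳ; *-zeroʳ; +-cancelʳ-≡)
open import Algebra.Properties.Semiring.Sum +-*-semiring
  using (sum; sum-syntax; sum-cong-≗; ∑-distrib-+; *-distribˡ-sum; sum-init-last; sum-remove; sum-replicate-zero)
open import Data.Nat.Tactic.RingSolver using (solve-∀)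
open import Data.Vec using (Vec; []; _∷_; toList)
import Data.Vec as Vec
open import Data.Vec.Properties using (toList-map)
open import Function using (_∘_; id)
open import Relation.Binary.PropositionalEquality
open import Relation.Nullary.Decidable using (does; yes; no)
open import Relation.Nullary.Negation using (contradiction)

open import Defs

variable
  A B : Set

∑-+-* : ∀ {n} (f g : Fin n → ℕ) a → ∑[ i < n ] (f i + a * g i) ≡ ∑[ i < n ] f i + a * ∑[ i < n ] g i
∑-+-* f g a = trans (∑-distrib-+ f (λ i → a * g i)) (cong (sum f +_) (sym (*-distribˡ-sum a g)))

∑-const : ∀ n x → ∑[ i < n ] x ≡ n * x
∑-const zero    x = refl
∑-const (suc n) x = cong (x +_) (∑-const n x)

count : (A → Bool) → List A → ℕ
count p xs = length (filterᵇ p xs)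

count-cong : ∀ {p q : A → Bool} → (∀ x → p x ≡ q x) → ∀ xs → count p xs ≡ count q xs
count-cong         p≗q []       = refl
count-cong {q = q} p≗q (x ∷ xs) rewrite p≗q x with q x
... | true  = cong suc (count-cong p≗q xs)
... | false = count-cong p≗q xs

count-false : ∀ (xs : List A) → count (λ _ → false) xs ≡ 0
count-false []       = refl
count-false (x ∷ xs) = count-false xs

count-++ : ∀ (p : A → Bool) xs ys → count p (xs ++ ys) ≡ count p xs + count p ys
count-++ p []       ys = refl
count-++ p (x ∷ xs) ys with p x
... | true  = cong suc (count-++ p xs ys)
... | false = count-++ p xs ys

count-map : ∀ (p : B → Bool) (f : A → B) xs → count p (map f xs) ≡ count (p ∘ f) xs
count-map p f []       = refl
count-map p f (x ∷ xs) with p (f x)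
... | true  = cong suc (count-map p f xs)
... | false = count-map p f xs

count-filterᵇ : ∀ (p q : A → Bool) xs → count p (filterᵇ q xs) ≡ count (λ x → q x ∧ p x) xs
count-filterᵇ p q []       = refl
count-filterᵇ p q (x ∷ xs) with q x
... | false = count-filterᵇ p q xs
... | true with p x
...   | true  = cong suc (count-filterᵇ p q xs)
...   | false = count-filterᵇ p q xs

count-if : ∀ (c p q : A → Bool) xs →
  count (λ x → if c x then p x else q x) xs
    ≡ count (λ x → c x ∧ p x) xs + count (λ x → not (c x) ∧ q x) xs
count-if c p q []       = refl
count-if c p q (x ∷ xs) with c x | p x | q x
... | true  | true  | _     = cong suc (count-if c p q xs)
... | true  | false | _     = count-if c p q xs
... | false | _     | true  = trans (cong suc (count-if c p q xs)) (sym (+-suc _ _))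
... | false | _     | false = count-if c p q xs

count-concatMap-tabulate : ∀ {n} (p : B → Bool) (f : A → List B) (g : Fin n → A) →
  count p (concatMap f (tabulate g)) ≡ ∑[ i < n ] count p (f (g i))
count-concatMap-tabulate {n = zero}  p f g = refl
count-concatMap-tabulate {n = suc n} p f g =
  trans (count-++ p (f (g zero)) _) (cong (count p (f (g zero)) +_) (count-concatMap-tabulate p f (g ∘ suc)))

count-words-suc : ∀ k n (p : Vec (Fin n) (suc k) → Bool) →
  count p (words (suc k) n) ≡ ∑[ i < n ] count (λ v → p (i ∷ v)) (words k n)
count-words-suc k n p = trans (count-concatMap-tabulate p (λ i → map (i ∷_) (words k n)) id)
  (sum-cong-≗ (λ i → count-map p (i ∷_) (words k n)))

-- The membership test local to distinctᵇ, which cannot be referred to from outside Defs.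
_∈ᵇ_ : ∀ {n} → Fin n → List (Fin n) → Bool
x ∈ᵇ []       = false
x ∈ᵇ (y ∷ ys) = does (x ≟ y) ∨ x ∈ᵇ ys

distinctᵇ-∷ : ∀ {n} (x : Fin n) xs → distinctᵇ (x ∷ xs) ≡ not (x ∈ᵇ xs) ∧ distinctᵇ xs
distinctᵇ-∷ x []       = refl
distinctᵇ-∷ x (y ∷ ys) = cancel-∧ (does (x ≟ y)) _ (x ∈ᵇ ys) _ (distinctᵇ ys) (distinctᵇ-∷ x ys)
  where
  cancel-∧ : ∀ q a b e c → not a ∧ c ≡ not b ∧ c → not (q ∨ a) ∧ (e ∧ c) ≡ not (q ∨ b) ∧ (e ∧ c)
  cancel-∧ true  a b e     c _ = refl
  cancel-∧ false a b false c _ = trans (∧-zeroʳ (not a)) (sym (∧-zeroʳ (not b)))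
  cancel-∧ false a b true  c h = h

does-≟-punchIn : ∀ {n} (j : Fin (suc n)) (x y : Fin n) → does (punchIn j x ≟ punchIn j y) ≡ does (x ≟ y)
does-≟-punchIn j x y with x ≟ y | punchIn j x ≟ punchIn j y
... | yes _   | yes _   = refl
... | no _    | no _    = refl
... | yes x≡y | no ≢    = contradiction (cong (punchIn j) x≡y) ≢
... | no x≢y  | yes ≡′  = contradiction (punchIn-injective j x y ≡′) x≢y

∈ᵇ-map-punchIn : ∀ {n} (j : Fin (suc n)) x xs → punchIn j x ∈ᵇ map (punchIn j) xs ≡ x ∈ᵇ xs
∈ᵇ-map-punchIn j x []       = refl
∈ᵇ-map-punchIn j x (y ∷ ys) = cong₂ _∨_ (does-≟-punchIn j x y) (∈ᵇ-map-punchIn j x ys)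

distinctᵇ-map-punchIn : ∀ {n} (j : Fin (suc n)) xs → distinctᵇ (map (punchIn j) xs) ≡ distinctᵇ xs
distinctᵇ-map-punchIn j []       = refl
distinctᵇ-map-punchIn j (x ∷ xs) = begin
  distinctᵇ (punchIn j x ∷ map (punchIn j) xs)
    ≡⟨ distinctᵇ-∷ (punchIn j x) (map (punchIn j) xs) ⟩
  not (punchIn j x ∈ᵇ map (punchIn j) xs) ∧ distinctᵇ (map (punchIn j) xs)
    ≡⟨ cong₂ (λ e d → not e ∧ d) (∈ᵇ-map-punchIn j x xs) (distinctᵇ-map-punchIn j xs) ⟩
  not (x ∈ᵇ xs) ∧ distinctᵇ xs
    ≡⟨ distinctᵇ-∷ x xs ⟨
  distinctᵇ (x ∷ xs) ∎
  where open ≡-Reasoning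

count-words-avoiding : ∀ k n (j : Fin (suc n)) (p : Vec (Fin (suc n)) k → Bool) →
  count (λ v → not (j ∈ᵇ toList v) ∧ p v) (words k (suc n))
    ≡ count (λ w → p (Vec.map (punchIn j) w)) (words k n)
count-words-avoiding zero    n j p with p []
... | true  = refl
... | false = refl
count-words-avoiding (suc k) n j p = begin
  count (λ v → not (j ∈ᵇ toList v) ∧ p v) (words (suc k) (suc n))
    ≡⟨ count-words-suc k (suc n) (λ v → not (j ∈ᵇ toList v) ∧ p v) ⟩
  ∑[ i < suc n ] block i
    ≡⟨ sum-remove {i = j} block ⟩
  block j + ∑[ i < n ] block (punchIn j i)
    ≡⟨ cong₂ _+_ block-j (sum-cong-≗ block-punchIn) ⟩
  ∑[ i < n ] count (λ w → p (Vec.map (punchIn j) (i ∷ w))) (words k n)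
    ≡⟨ count-words-suc k n (λ w → p (Vec.map (punchIn j) w)) ⟨
  count (λ w → p (Vec.map (punchIn j) w)) (words (suc k) n) ∎
  where
  open ≡-Reasoning
  block : Fin (suc n) → ℕ
  block i = count (λ v → not (j ∈ᵇ toList (i ∷ v)) ∧ p (i ∷ v)) (words k (suc n))
  block-j : block j ≡ 0
  block-j with j ≟ j
  ... | yes _  = count-false (words k (suc n))
  ... | no j≢j = contradiction refl j≢j
  block-punchIn : ∀ i → block (punchIn j i) ≡ count (λ w → p (Vec.map (punchIn j) (i ∷ w))) (words k n)
  block-punchIn i with j ≟ punchIn j i
  ... | yes j≡ = contradiction (sym j≡) (punchInᵢ≢i j i)
  ... | no _   = count-words-avoiding k n j (λ v → p (punchIn j i ∷ v))

count-Perms-suc : ∀ k (p : Vec (Fin (suc k)) (suc k) → Bool) →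
  count p (Perms (suc k)) ≡ ∑[ j < suc k ] count (λ τ → p (j ∷ Vec.map (punchIn j) τ)) (Perms k)
count-Perms-suc k p = begin
  count p (Perms (suc k))
    ≡⟨ count-filterᵇ p distinct (words (suc k) (suc k)) ⟩
  count (λ v → distinct v ∧ p v) (words (suc k) (suc k))
    ≡⟨ count-words-suc k (suc k) _ ⟩
  ∑[ j < suc k ] count (λ v → distinct (j ∷ v) ∧ p (j ∷ v)) (words k (suc k))
    ≡⟨ sum-cong-≗ block ⟩
  ∑[ j < suc k ] count (λ τ → p (j ∷ Vec.map (punchIn j) τ)) (Perms k) ∎
  where
  open ≡-Reasoning
  distinct : ∀ {n m} → Vec (Fin n) m → Bool
  distinct v = distinctᵇ (toList v)
  block : ∀ j → count (λ v → distinct (j ∷ v) ∧ p (j ∷ v)) (words k (suc k))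
              ≡ count (λ τ → p (j ∷ Vec.map (punchIn j) τ)) (Perms k)
  block j = begin
    count (λ v → distinct (j ∷ v) ∧ p (j ∷ v)) (words k (suc k))
      ≡⟨ count-cong (λ v → trans (cong (_∧ p (j ∷ v)) (distinctᵇ-∷ j (toList v)))
           (∧-assoc (not (j ∈ᵇ toList v)) (distinct v) (p (j ∷ v)))) (words k (suc k)) ⟩
    count (λ v → not (j ∈ᵇ toList v) ∧ (distinct v ∧ p (j ∷ v))) (words k (suc k))
      ≡⟨ count-words-avoiding k k j _ ⟩
    count (λ w → distinct (Vec.map (punchIn j) w) ∧ p (j ∷ Vec.map (punchIn j) w)) (words k k)
      ≡⟨ count-cong (λ w → cong (_∧ p (j ∷ Vec.map (punchIn j) w))
           (trans (cong distinctᵇ (toList-map (punchIn j) w)) (distinctᵇ-map-punchIn j (toList w)))) (words k k) ⟩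
    count (λ w → distinct w ∧ p (j ∷ Vec.map (punchIn j) w)) (words k k)
      ≡⟨ count-filterᵇ _ distinct (words k k) ⟨
    count (λ τ → p (j ∷ Vec.map (punchIn j) τ)) (Perms k) ∎

punchIn-<ᵇ : ∀ {n} (j : Fin (suc n)) (x y : Fin n) →
  (toℕ (punchIn j x) <ᵇ toℕ (punchIn j y)) ≡ (toℕ x <ᵇ toℕ y)
punchIn-<ᵇ zero    x       y       = refl
punchIn-<ᵇ (suc j) zero    zero    = refl
punchIn-<ᵇ (suc j) zero    (suc y) = refl
punchIn-<ᵇ (suc j) (suc x) zero    = refl
punchIn-<ᵇ (suc j) (suc x) (suc y) = punchIn-<ᵇ j x y

punchIn-<ᵇ-pivot : ∀ {n} (j : Fin (suc n)) (x : Fin n) →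
  (toℕ (punchIn j x) <ᵇ toℕ j) ≡ (toℕ x <ᵇ toℕ j)
punchIn-<ᵇ-pivot zero    x       = refl
punchIn-<ᵇ-pivot (suc j) zero    = refl
punchIn-<ᵇ-pivot (suc j) (suc x) = punchIn-<ᵇ-pivot j x

toℕ<ᵇn : ∀ {n} (i : Fin n) → (toℕ i <ᵇ n) ≡ true
toℕ<ᵇn {suc n} zero    = refl
toℕ<ᵇn {suc n} (suc i) = toℕ<ᵇn i

n≮ᵇtoℕ : ∀ {n} (i : Fin (suc n)) → (n <ᵇ toℕ i) ≡ false
n≮ᵇtoℕ         zero    = refl
n≮ᵇtoℕ {suc n} (suc i) = n≮ᵇtoℕ i

desList-map-punchIn : ∀ {n} (j : Fin (suc n)) xs → desList (map (punchIn j) xs) ≡ desList xs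
desList-map-punchIn j []           = refl
desList-map-punchIn j (x ∷ [])     = refl
desList-map-punchIn j (x ∷ y ∷ xs) =
  cong₂ (λ c r → (if c then 1 else 0) + r) (punchIn-<ᵇ j y x) (desList-map-punchIn j (y ∷ xs))

des-∷-punchIn : ∀ {n k} (j : Fin (suc n)) t (τ : Vec (Fin n) k) →
  des (j ∷ Vec.map (punchIn j) (t ∷ τ)) ≡ (if toℕ t <ᵇ toℕ j then 1 else 0) + des (t ∷ τ)
des-∷-punchIn j t τ = cong₂ (λ c r → (if c then 1 else 0) + r) (punchIn-<ᵇ-pivot j t)
  (trans (cong desList (toList-map (punchIn j) (t ∷ τ))) (desList-map-punchIn j (t ∷ toList τ)))

beginsWithAscent-∷-punchIn : ∀ {n k} (j : Fin (suc n)) t (τ : Vec (Fin n) k) →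
  beginsWithAscent (j ∷ Vec.map (punchIn j) (t ∷ τ)) ≡ not (toℕ t <ᵇ toℕ j)
beginsWithAscent-∷-punchIn j t τ = cong not (punchIn-<ᵇ-pivot j t)

-- Shift by one descent; the value at 0 is 0 as nothing has -1 descents.
_⁻ : (ℕ → ℕ) → ℕ → ℕ
(f ⁻) zero    = 0
(f ⁻) (suc d) = f d

⁻-sum : ∀ {n} (f : Fin n → ℕ → ℕ) (g : ℕ → ℕ) → (∀ d → g d ≡ ∑[ i < n ] f i d) →
  ∀ d → (g ⁻) d ≡ ∑[ i < n ] (f i ⁻) d
⁻-sum {n} f g g≡ zero    = sym (sum-replicate-zero n)
⁻-sum     f g g≡ (suc d) = g≡ d

recurrence-shift : ∀ (y x : ℕ → ℕ) m → (∀ d → y d + d * (x ⁻) d ≡ suc d * x d + m * (x ⁻) d) →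
  ∀ c d → (if c then y ⁻ else y) d + (x ⁻) d + d * ((if c then x ⁻ else x) ⁻) d
          ≡ suc d * (if c then x ⁻ else x) d + suc m * ((if c then x ⁻ else x) ⁻) d
recurrence-shift y x m rec false d = begin
  y d + (x ⁻) d + d * (x ⁻) d       ≡⟨ move-left (y d) ((x ⁻) d) d ⟩
  y d + d * (x ⁻) d + (x ⁻) d       ≡⟨ cong (_+ (x ⁻) d) (rec d) ⟩
  suc d * x d + m * (x ⁻) d + (x ⁻) d ≡⟨ absorb (suc d * x d) m ((x ⁻) d) ⟩
  suc d * x d + suc m * (x ⁻) d     ∎
  where
  open ≡-Reasoning
  move-left : ∀ y p d → y + p + d * p ≡ y + d * p + p
  move-left = solve-∀
  absorb : ∀ a m p → a + m * p + p ≡ a + suc m * p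
  absorb = solve-∀
recurrence-shift y x m rec true zero    = sym (*-zeroʳ (suc m))
recurrence-shift y x m rec true (suc d) = begin
  y d + x d + suc d * (x ⁻) d            ≡⟨ move-left (y d) (x d) d ((x ⁻) d) ⟩
  y d + d * (x ⁻) d + (x d + (x ⁻) d)     ≡⟨ cong (_+ (x d + (x ⁻) d)) (rec d) ⟩
  suc d * x d + m * (x ⁻) d + (x d + (x ⁻) d) ≡⟨ absorb d (x d) m ((x ⁻) d) ⟩
  suc (suc d) * x d + suc m * (x ⁻) d     ∎
  where
  open ≡-Reasoning
  move-left : ∀ y z d p → y + z + suc d * p ≡ y + d * p + (z + p)
  move-left = solve-∀
  absorb : ∀ d z m p → suc d * z + m * p + (z + p) ≡ suc (suc d) * z + suc m * p
  absorb = solve-∀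

count-shift : ∀ c (f : A → ℕ) xs d →
  count (λ x → ((if c then 1 else 0) + f x) == d) xs
    ≡ (if c then (λ e → count (λ x → f x == e) xs) ⁻ else (λ e → count (λ x → f x == e) xs)) d
count-shift true  f xs zero    = count-false xs
count-shift true  f xs (suc d) = refl
count-shift false f xs d       = refl

-- Eᶠ k j d: permutations of [k+1] with d descents and first entry j, written j ∷ punchIn j τ.
Eᶠ : (k : ℕ) → Fin (suc k) → ℕ → ℕ
Eᶠ k j d = count (λ τ → des (j ∷ Vec.map (punchIn j) τ) == d) (Perms k)

E-sum : ∀ k d → E (suc k) d ≡ ∑[ j < suc k ] Eᶠ k j d
E-sum k d = count-Perms-suc k (λ π → des π == d)

Eᶠ-suc : ∀ k (J : Fin (suc (suc k))) d →
  Eᶠ (suc k) J d ≡ ∑[ i < suc k ] (if toℕ i <ᵇ toℕ J then Eᶠ k i ⁻ else Eᶠ k i) d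
Eᶠ-suc k J d = begin
  Eᶠ (suc k) J d
    ≡⟨ count-Perms-suc k _ ⟩
  ∑[ i < suc k ] count (λ σ → des (J ∷ Vec.map (punchIn J) (start i σ)) == d) (Perms k)
    ≡⟨ sum-cong-≗ (λ i → count-cong (λ σ → cong (_== d) (des-∷-punchIn J i (Vec.map (punchIn i) σ))) (Perms k)) ⟩
  ∑[ i < suc k ] count (λ σ → (lt i + des (start i σ)) == d) (Perms k)
    ≡⟨ sum-cong-≗ (λ i → count-shift (toℕ i <ᵇ toℕ J) (λ σ → des (start i σ)) (Perms k) d) ⟩
  ∑[ i < suc k ] (if toℕ i <ᵇ toℕ J then Eᶠ k i ⁻ else Eᶠ k i) d ∎
  where
  open ≡-Reasoning
  start : (i : Fin (suc k)) → Vec (Fin k) k → Vec (Fin (suc k)) (suc k)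
  start i σ = i ∷ Vec.map (punchIn i) σ
  lt : Fin (suc k) → ℕ
  lt i = if toℕ i <ᵇ toℕ J then 1 else 0

Eᶠ-last : ∀ k d → Eᶠ (suc k) (fromℕ (suc k)) d ≡ ∑[ i < suc k ] (Eᶠ k i ⁻) d
Eᶠ-last k d = trans (Eᶠ-suc k (fromℕ (suc k)) d) (sum-cong-≗ λ i →
  cong (λ c → (if c then Eᶠ k i ⁻ else Eᶠ k i) d)
    (trans (cong (toℕ i <ᵇ_) (toℕ-fromℕ (suc k))) (toℕ<ᵇn i)))

-- Inserting the largest letter anywhere except in front keeps the first entry, which gives
-- Eᶠ (k+1) i d = (d+1) Eᶠ k i d + (k+1-d) Eᶠ k i (d-1); we prove it by induction on k instead.
Eᶠ-recurrence : ∀ k (i : Fin (suc k)) d →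
  Eᶠ (suc k) (inject₁ i) d + d * (Eᶠ k i ⁻) d ≡ suc d * Eᶠ k i d + suc k * (Eᶠ k i ⁻) d
Eᶠ-recurrence zero    zero zero          = refl
Eᶠ-recurrence zero    zero (suc zero)    = refl
Eᶠ-recurrence zero    zero (suc (suc d)) rewrite *-zeroʳ d = refl
Eᶠ-recurrence (suc k) J    d             = begin
  Eᶠ (suc (suc k)) (inject₁ J) d + d * (Y J ⁻) d
    ≡⟨ cong₂ _+_ first-entry-split (cong (d *_) (⁻-sum u (Y J) (Eᶠ-suc k J) d)) ⟩
  ∑[ i < suc k ] v i d + ∑[ i < suc k ] (X i ⁻) d + d * ∑[ i < suc k ] (u i ⁻) d
    ≡⟨ cong (_+ d * ∑[ i < suc k ] (u i ⁻) d) (∑-distrib-+ (λ i → v i d) (λ i → (X i ⁻) d)) ⟨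
  ∑[ i < suc k ] (v i d + (X i ⁻) d) + d * ∑[ i < suc k ] (u i ⁻) d
    ≡⟨ ∑-+-* (λ i → v i d + (X i ⁻) d) (λ i → (u i ⁻) d) d ⟨
  ∑[ i < suc k ] (v i d + (X i ⁻) d + d * (u i ⁻) d)
    ≡⟨ sum-cong-≗ (λ i → recurrence-shift (Y (inject₁ i)) (X i) (suc k) (Eᶠ-recurrence k i) (c i) d) ⟩
  ∑[ i < suc k ] (suc d * u i d + suc (suc k) * (u i ⁻) d)
    ≡⟨ ∑-+-* (λ i → suc d * u i d) (λ i → (u i ⁻) d) (suc (suc k)) ⟩
  ∑[ i < suc k ] (suc d * u i d) + suc (suc k) * ∑[ i < suc k ] (u i ⁻) d
    ≡⟨ cong₂ (λ s t → s + suc (suc k) * t)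
         (trans (sym (*-distribˡ-sum (suc d) (λ i → u i d))) (cong (suc d *_) (sym (Eᶠ-suc k J d))))
         (sym (⁻-sum u (Y J) (Eᶠ-suc k J) d)) ⟩
  suc d * Y J d + suc (suc k) * (Y J ⁻) d ∎
  where
  open ≡-Reasoning
  X = Eᶠ k
  Y = Eᶠ (suc k)
  c : Fin (suc k) → Bool
  c i = toℕ i <ᵇ toℕ J
  u v : Fin (suc k) → ℕ → ℕ
  u i = if c i then X i ⁻ else X i
  v i = if c i then Y (inject₁ i) ⁻ else Y (inject₁ i)
  w : Fin (suc (suc k)) → ℕ
  w i = (if toℕ i <ᵇ toℕ (inject₁ J) then Y i ⁻ else Y i) d
  w-inject₁ : ∀ i → w (inject₁ i) ≡ v i d
  w-inject₁ i = cong (λ t → (if t then Y (inject₁ i) ⁻ else Y (inject₁ i)) d)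
    (cong₂ _<ᵇ_ (toℕ-inject₁ i) (toℕ-inject₁ J))
  w-last : w (fromℕ (suc k)) ≡ ∑[ i < suc k ] (X i ⁻) d
  w-last = trans (cong (λ t → (if t then Y (fromℕ (suc k)) ⁻ else Y (fromℕ (suc k))) d)
      (trans (cong₂ _<ᵇ_ (toℕ-fromℕ (suc k)) (toℕ-inject₁ J)) (n≮ᵇtoℕ J)))
    (Eᶠ-last k d)
  first-entry-split : Eᶠ (suc (suc k)) (inject₁ J) d ≡ ∑[ i < suc k ] v i d + ∑[ i < suc k ] (X i ⁻) d
  first-entry-split = begin
    Eᶠ (suc (suc k)) (inject₁ J) d                       ≡⟨ Eᶠ-suc (suc k) (inject₁ J) d ⟩
    ∑[ i < suc (suc k) ] w i                             ≡⟨ sum-init-last w ⟩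
    ∑[ i < suc k ] w (inject₁ i) + w (fromℕ (suc k))      ≡⟨ cong₂ _+_ (sum-cong-≗ w-inject₁) w-last ⟩
    ∑[ i < suc k ] v i d + ∑[ i < suc k ] (X i ⁻) d       ∎

E-recurrence : ∀ k d →
  E (suc (suc k)) d + d * (E (suc k) ⁻) d ≡ suc d * E (suc k) d + suc (suc k) * (E (suc k) ⁻) d
E-recurrence k d =
  trans (cong (_+ d * (E (suc k) ⁻) d) split) (recurrence-shift y (E (suc k)) (suc k) summed false d)
  where
  open ≡-Reasoning
  y : ℕ → ℕ
  y e = ∑[ i < suc k ] Eᶠ (suc k) (inject₁ i) e
  E⁻-sum : ∀ d → (E (suc k) ⁻) d ≡ ∑[ i < suc k ] (Eᶠ k i ⁻) d
  E⁻-sum = ⁻-sum (Eᶠ k) (E (suc k)) (E-sum k)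
  split : E (suc (suc k)) d ≡ y d + (E (suc k) ⁻) d
  split = begin
    E (suc (suc k)) d                                       ≡⟨ E-sum (suc k) d ⟩
    ∑[ j < suc (suc k) ] Eᶠ (suc k) j d                      ≡⟨ sum-init-last (λ j → Eᶠ (suc k) j d) ⟩
    y d + Eᶠ (suc k) (fromℕ (suc k)) d                      ≡⟨ cong (y d +_) (Eᶠ-last k d) ⟩
    y d + ∑[ i < suc k ] (Eᶠ k i ⁻) d                        ≡⟨ cong (y d +_) (E⁻-sum d) ⟨
    y d + (E (suc k) ⁻) d                                   ∎
  summed : ∀ d → y d + d * (E (suc k) ⁻) d ≡ suc d * E (suc k) d + suc k * (E (suc k) ⁻) d
  summed e = begin
    y e + e * (E (suc k) ⁻) e
      ≡⟨ cong (λ s → y e + e * s) (E⁻-sum e) ⟩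
    y e + e * ∑[ i < suc k ] (Eᶠ k i ⁻) e
      ≡⟨ ∑-+-* (λ i → Eᶠ (suc k) (inject₁ i) e) (λ i → (Eᶠ k i ⁻) e) e ⟨
    ∑[ i < suc k ] (Eᶠ (suc k) (inject₁ i) e + e * (Eᶠ k i ⁻) e)
      ≡⟨ sum-cong-≗ (λ i → Eᶠ-recurrence k i e) ⟩
    ∑[ i < suc k ] (suc e * Eᶠ k i e + suc k * (Eᶠ k i ⁻) e)
      ≡⟨ ∑-+-* (λ i → suc e * Eᶠ k i e) (λ i → (Eᶠ k i ⁻) e) (suc k) ⟩
    ∑[ i < suc k ] (suc e * Eᶠ k i e) + suc k * ∑[ i < suc k ] (Eᶠ k i ⁻) e
      ≡⟨ cong₂ (λ s t → s + suc k * t)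
           (trans (sym (*-distribˡ-sum (suc e) (λ i → Eᶠ k i e))) (cong (suc e *_) (sym (E-sum k e))))
           (sym (E⁻-sum e)) ⟩
    suc e * E (suc k) e + suc k * (E (suc k) ⁻) e ∎

b : ℕ → ℕ → ℕ
b n d = count (λ π → not (beginsWithAscent π) ∧ (des π == d)) (Perms n)

a+b≡E : ∀ n d → a n d + b n d ≡ E n d
a+b≡E n d = sym (trans
  (count-cong {q = λ π → if beginsWithAscent π then des π == d else des π == d}
    (λ π → sym (if-eta (beginsWithAscent π))) (Perms n))
  (count-if beginsWithAscent (λ π → des π == d) (λ π → des π == d) (Perms n)))

b-zero : ∀ n → b n 0 ≡ 0
b-zero n = trans (count-cong (λ π → descent-start-has-descent (toList π)) (Perms n)) (count-false (Perms n))
  where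
  descent-start-has-descent : ∀ {m} (xs : List (Fin m)) →
    not (beginsWithAscentList xs) ∧ (desList xs == 0) ≡ false
  descent-start-has-descent []           = refl
  descent-start-has-descent (x ∷ [])     = refl
  descent-start-has-descent (x ∷ y ∷ xs) with toℕ y <ᵇ toℕ x
  ... | true  = refl
  ... | false = refl

a+b-suc≡*E : ∀ k d → a (suc (suc k)) d + b (suc (suc k)) (suc d) ≡ suc (suc k) * E (suc k) d
a+b-suc≡*E k d = begin
  a (suc (suc k)) d + b (suc (suc k)) (suc d)
    ≡⟨ count-if beginsWithAscent (λ π → des π == d) (λ π → des π == suc d) (Perms (suc (suc k))) ⟨
  count (λ π → if beginsWithAscent π then des π == d else des π == suc d) (Perms (suc (suc k)))
    ≡⟨ count-Perms-suc (suc k) _ ⟩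
  ∑[ j < suc (suc k) ] count (λ τ → if beginsWithAscent (j ∷ Vec.map (punchIn j) τ)
                                     then des (j ∷ Vec.map (punchIn j) τ) == d
                                     else des (j ∷ Vec.map (punchIn j) τ) == suc d) (Perms (suc k))
    ≡⟨ sum-cong-≗ (λ j → count-cong (des-after-first-entry j) (Perms (suc k))) ⟩
  ∑[ j < suc (suc k) ] E (suc k) d
    ≡⟨ ∑-const (suc (suc k)) (E (suc k) d) ⟩
  suc (suc k) * E (suc k) d ∎
  where
  open ≡-Reasoning
  des-after-first-entry : ∀ j (τ : Vec (Fin (suc k)) (suc k)) →
    (if beginsWithAscent (j ∷ Vec.map (punchIn j) τ)
     then des (j ∷ Vec.map (punchIn j) τ) == d
     else des (j ∷ Vec.map (punchIn j) τ) == suc d) ≡ (des τ == d)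
  des-after-first-entry j (t ∷ τ) rewrite beginsWithAscent-∷-punchIn j t τ | des-∷-punchIn j t τ
    with toℕ t <ᵇ toℕ j
  ... | true  = refl
  ... | false = refl

a≡suc*E : ∀ k d → a (suc (suc k)) d ≡ suc d * E (suc k) d
a≡suc*E k zero = begin
  a (suc (suc k)) 0                             ≡⟨ +-identityʳ _ ⟨
  a (suc (suc k)) 0 + 0                         ≡⟨ cong (a (suc (suc k)) 0 +_) (b-zero (suc (suc k))) ⟨
  a (suc (suc k)) 0 + b (suc (suc k)) 0         ≡⟨ a+b≡E (suc (suc k)) 0 ⟩
  E (suc (suc k)) 0                             ≡⟨ +-identityʳ _ ⟨
  E (suc (suc k)) 0 + 0                         ≡⟨ E-recurrence k 0 ⟩
  1 * E (suc k) 0 + suc (suc k) * 0             ≡⟨ cong (1 * E (suc k) 0 +_) (*-zeroʳ (suc (suc k))) ⟩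
  1 * E (suc k) 0 + 0                           ≡⟨ +-identityʳ _ ⟩
  1 * E (suc k) 0                               ∎
  where open ≡-Reasoning
a≡suc*E k (suc d) = +-cancelʳ-≡ _ (a (suc (suc k)) (suc d)) (suc (suc d) * E (suc k) (suc d)) (begin
  a′ + (b′ + suc d * E (suc k) d)               ≡⟨ +-assoc a′ b′ _ ⟨
  a′ + b′ + suc d * E (suc k) d                 ≡⟨ cong (_+ suc d * E (suc k) d) (a+b≡E (suc (suc k)) (suc d)) ⟩
  E (suc (suc k)) (suc d) + suc d * E (suc k) d ≡⟨ E-recurrence k (suc d) ⟩
  suc (suc d) * E (suc k) (suc d) + suc (suc k) * E (suc k) d
    ≡⟨ cong (suc (suc d) * E (suc k) (suc d) +_) (a+b-suc≡*E k d) ⟨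
  suc (suc d) * E (suc k) (suc d) + (a (suc (suc k)) d + b′)
    ≡⟨ cong (λ s → suc (suc d) * E (suc k) (suc d) + (s + b′)) (a≡suc*E k d) ⟩
  suc (suc d) * E (suc k) (suc d) + (suc d * E (suc k) d + b′)
    ≡⟨ cong (suc (suc d) * E (suc k) (suc d) +_) (+-comm _ b′) ⟩
  suc (suc d) * E (suc k) (suc d) + (b′ + suc d * E (suc k) d) ∎)
  where
  open ≡-Reasoning
  a′ = a (suc (suc k)) (suc d)
  b′ = b (suc (suc k)) (suc d)

proposition1p6 : (n d : ℕ) → 1 ≤ n → a n d ≡ suc d * E (n ∸ 1) d
proposition1p6 (suc zero)    zero    _ = refl
proposition1p6 (suc zero)    (suc d) _ = sym (*-zeroʳ (suc (suc d)))
proposition1p6 (suc (suc k)) d       _ = a≡suc*E k d
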